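{- Let $L=C_1]_0^1C_2$ be an adjunct of two finite chains $C_1,C_2$ with adjunct pair $(0,1)$. Then $L$ is $0$-distributive.
   Context: Adjunct operation: for disjoint finite lattices $L_1,L_2$ and $a<b$ in $L_1$ with $b$ not covering $a$, $L_1]_a^bL_2$ is $L_1\cup L_2$ ordered by: $x\le y$ iff ($x,y\in L_1$, $x\le y$ in $L_1$) or ($x,y\in L_2$, $x\le y$ in $L_2$) or ($x\in L_1$, $y\in L_2$, $x\le a$) or ($x\in L_2$, $y\in L_1$, $b\le y$). Here $0,1$ are the least and greatest elements of $C_1$. A lattice $L$ with $0$ is $0$-distributive if for all $a,b,c\in L$, $a\wedge b=a\wedge c=0$ implies $a\wedge(b\vee c)=0$. -}

module Defs where

open import Level using (0ℓ)
open import Data.Nat using (ℕ; suc)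
open import Data.Fin using (Fin; zero; fromℕ) renaming (_≤_ to _≤F_; _<_ to _<F_)
open import Data.Sum using (_⊎_; inj₁; inj₂)
open import Data.Product using (Σ; _×_)
open import Data.Empty using (⊥)
open import Relation.Nullary using (¬_)

-- A finite chain with k elements is (up to isomorphism) Fin k with its
-- natural order.  "y covers x" in a chain: x < y and nothing strictly between.
_covers_ : ∀ {k} → Fin k → Fin k → Set
_covers_ {k} y x = x <F y × (∀ (z : Fin k) → x <F z → z <F y → ⊥)

-- Adjunct L₁ ]_a^b L₂ of two finite chains L₁ = Fin p, L₂ = Fin q
-- (disjointness is built in by using the disjoint sum as carrier).
module Adjunct {p q : ℕ} (a b : Fin p) where

  Carrier : Set
  Carrier = Fin p ⊎ Fin q

  _≼_ : Carrier → Carrier → Set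
  inj₁ x ≼ inj₁ y = x ≤F y
  inj₂ x ≼ inj₂ y = x ≤F y
  inj₁ x ≼ inj₂ y = x ≤F a
  inj₂ x ≼ inj₁ y = b ≤F y

module _ {A : Set} (_≤_ : A → A → Set) where

  IsGlb : A → A → A → Set
  IsGlb x y z = (z ≤ x) × (z ≤ y) × (∀ w → w ≤ x → w ≤ y → w ≤ z)

  IsLub : A → A → A → Set
  IsLub x y z = (x ≤ z) × (y ≤ z) × (∀ w → x ≤ w → y ≤ w → z ≤ w)

  IsLeast : A → Set
  IsLeast o = ∀ x → o ≤ x

  IsZeroDistributiveLattice : A → Set
  IsZeroDistributiveLattice o =
    (∀ x y → Σ A (IsGlb x y)) ×
    (∀ x y → Σ A (IsLub x y)) ×
    IsLeast o ×
    (∀ x y z d → IsGlb x y o → IsGlb x z o → IsLub y z d → IsGlb x d o)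

-- Outside its bottom 0 and top 1, the adjunct C₁]₀¹C₂ consists of two
-- incomparable chains: the interior of C₁ and all of C₂.  Hence every element
-- has a pseudocomplement: 1 for 0, 0 for 1, the top of C₂ for an interior
-- element of C₁, and the coatom of C₁ for an element of C₂.  A lattice with
-- pseudocomplements is 0-distributive, since the elements disjoint from x are
-- exactly those below x*, and these are closed under joins.
module Submission where

open import Defs
open import Data.Nat using (ℕ; suc)
open import Data.Fin using (Fin; zero; suc; fromℕ; _<_; toℕ; inject₁)
  renaming (_≤_ to _≤F_)
open import Data.Fin.Properties using (≤fromℕ; ≤-total; _≤?_; toℕ-inject₁)
import Data.Nat as ℕ
import Data.Nat.Properties as ℕ
open import Data.Sum using (_⊎_; inj₁; inj₂)
open import Data.Product using (Σ; _×_; _,_; proj₂)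
open import Data.Empty using (⊥-elim)
open import Relation.Nullary using (¬_; yes; no)
open import Relation.Binary.PropositionalEquality using (refl; subst; sym)

module Bounds {A : Set} (_≤_ : A → A → Set) where

  IsGlb-sym : ∀ {x y z} → IsGlb _≤_ x y z → IsGlb _≤_ y x z
  IsGlb-sym (z≤x , z≤y , greatest) = z≤y , z≤x , λ w w≤y w≤x → greatest w w≤x w≤y

  IsLub-sym : ∀ {x y z} → IsLub _≤_ x y z → IsLub _≤_ y x z
  IsLub-sym (x≤z , y≤z , least) = y≤z , x≤z , λ w y≤w x≤w → least w x≤w y≤w

  module _ (≤-refl : ∀ {x} → x ≤ x) where

    comparable⇒glb : ∀ {x y} → x ≤ y ⊎ y ≤ x → Σ A (IsGlb _≤_ x y)
    comparable⇒glb {x} (inj₁ x≤y) = x , ≤-refl , x≤y , λ _ w≤x _ → w≤x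
    comparable⇒glb {y = y} (inj₂ y≤x) = y , y≤x , ≤-refl , λ _ _ w≤y → w≤y

    comparable⇒lub : ∀ {x y} → x ≤ y ⊎ y ≤ x → Σ A (IsLub _≤_ x y)
    comparable⇒lub {y = y} (inj₁ x≤y) = y , x≤y , ≤-refl , λ _ _ y≤w → y≤w
    comparable⇒lub {x} (inj₂ y≤x) = x , ≤-refl , y≤x , λ _ x≤w _ → x≤w

    glb-≤-zero : ∀ {x y o} → IsGlb _≤_ x y o → x ≤ y → x ≤ o
    glb-≤-zero (_ , _ , greatest) x≤y = greatest _ ≤-refl x≤y

  IsPseudocomplement : A → A → A → Set
  IsPseudocomplement o x s = (∀ w → w ≤ x → w ≤ s → w ≤ o) × (∀ y → IsGlb _≤_ x y o → y ≤ s)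

  pseudocomplemented⇒0-distributive :
    (∀ {x y z} → x ≤ y → y ≤ z → x ≤ z) → ∀ {o x s y z d} → IsLeast _≤_ o →
    IsPseudocomplement o x s →
    IsGlb _≤_ x y o → IsGlb _≤_ x z o → IsLub _≤_ y z d → IsGlb _≤_ x d o
  pseudocomplemented⇒0-distributive ≤-trans {x = x} {d = d}
    least (disjoint , maximal) x∧y x∧z (_ , _ , d-least) =
    least x , least d , λ w w≤x w≤d → disjoint w w≤x (≤-trans w≤d d≤s)
    where d≤s = d-least _ (maximal _ x∧y) (maximal _ x∧z)

module ChainAdjunct (k n : ℕ) where
  open Adjunct {suc (suc k)} {suc n} zero (fromℕ (suc k))
  open Bounds _≼_

  ⊤₁ : Fin (suc (suc k))
  ⊤₁ = fromℕ (suc k)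

  ⊤₁⁻ : Fin (suc (suc k))
  ⊤₁⁻ = inject₁ (fromℕ k)

  ⊤₂ : Fin (suc n)
  ⊤₂ = fromℕ n

  𝟘 : Carrier
  𝟘 = inj₁ zero

  ≼-refl : ∀ {u} → u ≼ u
  ≼-refl {inj₁ x} = ℕ.≤-refl
  ≼-refl {inj₂ y} = ℕ.≤-refl

  ≼-trans : ∀ {u v w} → u ≼ v → v ≼ w → u ≼ w
  ≼-trans {inj₁ _} {inj₁ _} {inj₁ _} p q = ℕ.≤-trans p q
  ≼-trans {inj₁ _} {inj₁ _} {inj₂ _} p q = ℕ.≤-trans p q
  ≼-trans {inj₁ _} {inj₂ _} {inj₁ _} p q = ℕ.≤-trans p ℕ.z≤n
  ≼-trans {inj₁ _} {inj₂ _} {inj₂ _} p q = p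
  ≼-trans {inj₂ _} {inj₁ _} {inj₁ _} p q = ℕ.≤-trans p q
  ≼-trans {inj₂ _} {inj₁ _} {inj₂ _} p q with () ← ℕ.≤-trans p q
  ≼-trans {inj₂ _} {inj₂ _} {inj₁ _} p q = q
  ≼-trans {inj₂ _} {inj₂ _} {inj₂ _} p q = ℕ.≤-trans p q

  𝟘-least : IsLeast _≼_ 𝟘
  𝟘-least (inj₁ _) = ℕ.z≤n
  𝟘-least (inj₂ _) = ℕ.z≤n

  ≼-top : ∀ {x} → ⊤₁ ≤F x → ∀ u → u ≼ inj₁ x
  ≼-top ⊤₁≤x (inj₁ y) = ℕ.≤-trans (≤fromℕ y) ⊤₁≤x
  ≼-top ⊤₁≤x (inj₂ _) = ⊤₁≤x

  ⊤₁≰⊤₁⁻ : ¬ (⊤₁ ≤F ⊤₁⁻)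
  ⊤₁≰⊤₁⁻ ⊤₁≤⊤₁⁻ = ℕ.<-irrefl refl (subst (toℕ ⊤₁ ℕ.≤_) (toℕ-inject₁ (fromℕ k)) ⊤₁≤⊤₁⁻)

  ⊤₁≰⇒≤⊤₁⁻ : ∀ {x : Fin (suc (suc k))} → ¬ (⊤₁ ≤F x) → x ≤F ⊤₁⁻
  ⊤₁≰⇒≤⊤₁⁻ {x} ⊤₁≰x = subst (toℕ x ℕ.≤_) (sym (toℕ-inject₁ (fromℕ k))) (ℕ.s≤s⁻¹ (ℕ.≰⇒> ⊤₁≰x))

  data Position : Fin (suc (suc k)) → Set where
    bottom   : Position zero
    top      : ∀ {x} → ⊤₁ ≤F x → Position x
    interior : ∀ {x} → ¬ (⊤₁ ≤F suc x) → Position (suc x)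

  position : ∀ x → Position x
  position zero = bottom
  position (suc x) with ⊤₁ ≤? suc x
  ... | yes ⊤₁≤x = top ⊤₁≤x
  ... | no ⊤₁≰x = interior ⊤₁≰x

  meet₁₂ : ∀ x y → Σ Carrier (IsGlb _≼_ (inj₁ x) (inj₂ y))
  meet₁₂ x y with position x
  ... | bottom = comparable⇒glb ≼-refl (inj₁ ℕ.z≤n)
  ... | top ⊤₁≤x = comparable⇒glb ≼-refl (inj₂ ⊤₁≤x)
  ... | interior ⊤₁≰x = 𝟘 , ℕ.z≤n , ℕ.z≤n , λ where
    (inj₁ _) _ w≤0 → w≤0
    (inj₂ _) ⊤₁≤x _ → ⊥-elim (⊤₁≰x ⊤₁≤x)

  join₁₂ : ∀ x y → Σ Carrier (IsLub _≼_ (inj₁ x) (inj₂ y))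
  join₁₂ x y with position x
  ... | bottom = comparable⇒lub ≼-refl (inj₁ ℕ.z≤n)
  ... | top ⊤₁≤x = comparable⇒lub ≼-refl (inj₂ ⊤₁≤x)
  ... | interior _ = inj₁ ⊤₁ , ≤fromℕ x , ℕ.≤-refl , λ where
    (inj₁ _) _ ⊤₁≤w → ⊤₁≤w
    (inj₂ _) () _

  meet : ∀ u v → Σ Carrier (IsGlb _≼_ u v)
  meet (inj₁ x) (inj₁ y) = comparable⇒glb ≼-refl (≤-total x y)
  meet (inj₂ x) (inj₂ y) = comparable⇒glb ≼-refl (≤-total x y)
  meet (inj₁ x) (inj₂ y) = meet₁₂ x y
  meet (inj₂ y) (inj₁ x) with meet₁₂ x y
  ... | z , x∧y = z , IsGlb-sym x∧y

  join : ∀ u v → Σ Carrier (IsLub _≼_ u v)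
  join (inj₁ x) (inj₁ y) = comparable⇒lub ≼-refl (≤-total x y)
  join (inj₂ x) (inj₂ y) = comparable⇒lub ≼-refl (≤-total x y)
  join (inj₁ x) (inj₂ y) = join₁₂ x y
  join (inj₂ y) (inj₁ x) with join₁₂ x y
  ... | z , x∨y = z , IsLub-sym x∨y

  pseudocomplement₁ : ∀ x → Σ Carrier (IsPseudocomplement 𝟘 (inj₁ x))
  pseudocomplement₁ x with position x
  ... | bottom = inj₁ ⊤₁ , (λ _ w≼𝟘 _ → w≼𝟘) , (λ y _ → ≼-top ℕ.≤-refl y)
  ... | top ⊤₁≤x = 𝟘 , (λ _ _ w≼𝟘 → w≼𝟘) , λ y x∧y → glb-≤-zero ≼-refl (IsGlb-sym x∧y) (≼-top ⊤₁≤x y)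
  ... | interior ⊤₁≰x = inj₂ ⊤₂ , disjoint , maximal
    where
    disjoint : ∀ w → w ≼ inj₁ x → w ≼ inj₂ ⊤₂ → w ≼ 𝟘
    disjoint (inj₁ _) _ w≤0 = w≤0
    disjoint (inj₂ _) ⊤₁≤x _ = ⊥-elim (⊤₁≰x ⊤₁≤x)
    maximal : ∀ v → IsGlb _≼_ (inj₁ x) v 𝟘 → v ≼ inj₂ ⊤₂
    maximal (inj₂ y) _ = ≤fromℕ y
    maximal (inj₁ y) x∧y with ≤-total x y
    ... | inj₁ x≤y with () ← glb-≤-zero ≼-refl x∧y x≤y
    ... | inj₂ y≤x = glb-≤-zero ≼-refl (IsGlb-sym x∧y) y≤x

  pseudocomplement₂ : ∀ y → Σ Carrier (IsPseudocomplement 𝟘 (inj₂ y))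
  pseudocomplement₂ y = inj₁ ⊤₁⁻ , disjoint , maximal
    where
    disjoint : ∀ w → w ≼ inj₂ y → w ≼ inj₁ ⊤₁⁻ → w ≼ 𝟘
    disjoint (inj₁ _) w≤0 _ = w≤0
    disjoint (inj₂ _) _ ⊤₁≤⊤₁⁻ = ⊥-elim (⊤₁≰⊤₁⁻ ⊤₁≤⊤₁⁻)
    maximal : ∀ v → IsGlb _≼_ (inj₂ y) v 𝟘 → v ≼ inj₁ ⊤₁⁻
    maximal (inj₂ z) y∧z with ≤-total y z
    ... | inj₁ y≤z with () ← glb-≤-zero ≼-refl y∧z y≤z
    ... | inj₂ z≤y with () ← glb-≤-zero ≼-refl (IsGlb-sym y∧z) z≤y
    maximal (inj₁ x) y∧x with ⊤₁ ≤? x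
    ... | yes ⊤₁≤x with () ← glb-≤-zero ≼-refl y∧x ⊤₁≤x
    ... | no ⊤₁≰x = ⊤₁≰⇒≤⊤₁⁻ ⊤₁≰x

  pseudocomplement : ∀ u → Σ Carrier (IsPseudocomplement 𝟘 u)
  pseudocomplement (inj₁ x) = pseudocomplement₁ x
  pseudocomplement (inj₂ y) = pseudocomplement₂ y

lemma2p14 : (m n : ℕ) →
    _<_ {suc m} zero (fromℕ m) → ¬ (_covers_ {suc m} (fromℕ m) zero) →
    IsZeroDistributiveLattice (Adjunct._≼_ {suc m} {suc n} zero (fromℕ m)) (inj₁ zero)
lemma2p14 ℕ.zero n () _
lemma2p14 (suc k) n _ _ =
  meet , join , 𝟘-least ,
  λ x _ _ _ → pseudocomplemented⇒0-distributive ≼-trans 𝟘-least (proj₂ (pseudocomplement x))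
  where
  open ChainAdjunct k n
  open Bounds (Adjunct._≼_ {suc (suc k)} {suc n} zero (fromℕ (suc k)))
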